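{- Let $G$ be a graph, let $X,Y$ be distinct strongly nested vertex sets, and let $(A_X,B_X)$ and $(A_Y,B_Y)$ be separations of $G$ with separators $A_X\cap B_X=X$ and $A_Y\cap B_Y=Y$, such that $Y\subseteq B_X$ and $X\subseteq B_Y$. Then either $(A_X,B_X)$ and $(A_Y,B_Y)$ are nested, or there is a component $C$ of $G-(X\cap Y)$ which meets neither $X$ nor $Y$.
   Context: A separation of $G=(V,E)$ is a pair $(A,B)$ with $A\cup B=V$ and no edge between $A\smallsetminus B$ and $B\smallsetminus A$. $(A,B)\le(C,D)$ iff $A\subseteq C$ and $B\supseteq D$; two separations are nested if suitable orientations (each of $(A,B),(B,A)$) are comparable. Vertex sets $X,Y$ are strongly nested if there is a component $C$ of $G-X$ with $Y\subseteq C\cup N(C)$ and a component $C'$ of $G-Y$ with $X\subseteq C'\cup N(C')$. -}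

module Defs where

open import Level using (0ℓ)
open import Data.Product using (Σ; ∃; _×_; _,_)
open import Data.Sum using (_⊎_)
open import Relation.Nullary using (¬_)
open import Relation.Unary using (Pred; _⊆_)
open import Function.Bundles using (_⇔_)

record Graph : Set₁ where
  field
    V     : Set
    E     : V → V → Set
    sym   : ∀ {u v} → E u v → E v u
    irrefl : ∀ {v} → ¬ E v v

module _ (G : Graph) where
  open Graph G

  VSet : Set₁
  VSet = Pred V 0ℓ

  data WalkIn (S : VSet) : V → V → Set where
    nil  : ∀ {u} → S u → WalkIn S u u
    cons : ∀ {u w v} → S u → E u w → WalkIn S w v → WalkIn S u v

  -- C is a component of G - X: a nonempty, connected vertex set avoiding X
  -- that is maximal, i.e. closed under adjacency in G - X.
  record IsComponentOfMinus (X C : VSet) : Set where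
    field
      nonempty  : ∃ λ v → C v
      avoids    : ∀ v → C v → ¬ X v
      connected : ∀ u v → C u → C v → WalkIn C u v
      maximal   : ∀ u v → C u → E u v → ¬ X v → C v

  N : VSet → VSet
  N C v = ¬ C v × ∃ λ u → C u × E u v

  _∪_ : VSet → VSet → VSet
  (S ∪ T) v = S v ⊎ T v

  _∩_ : VSet → VSet → VSet
  (S ∩ T) v = S v × T v

  Meets : VSet → VSet → Set
  Meets S T = ∃ λ v → S v × T v

  _≐_ : VSet → VSet → Set
  S ≐ T = ∀ v → S v ⇔ T v

  StronglyNested : VSet → VSet → Set₁
  StronglyNested X Y =
    (Σ VSet λ C → IsComponentOfMinus X C × (Y ⊆ (C ∪ N C))) ×
    (Σ VSet λ C' → IsComponentOfMinus Y C' × (X ⊆ (C' ∪ N C')))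

  IsSeparation : VSet → VSet → Set
  IsSeparation A B =
    (∀ v → A v ⊎ B v) ×
    (∀ u v → A u → ¬ B u → B v → ¬ A v → ¬ E u v)

  SepLeq : VSet → VSet → VSet → VSet → Set
  SepLeq A B C D = (A ⊆ C) × (D ⊆ B)

  Nested : VSet → VSet → VSet → VSet → Set
  Nested A B C D =
    SepLeq A B C D ⊎ SepLeq A B D C ⊎ SepLeq B A C D ⊎ SepLeq B A D C

{-# OPTIONS --safe #-}
module Submission where

open import Defs
open import Level using (0ℓ)
open import Data.Product using (Σ; ∃; _×_; _,_; proj₂)
open import Data.Sum using (_⊎_; inj₁; inj₂)
open import Data.Empty using (⊥-elim)
open import Relation.Nullary using (¬_; yes; no)
open import Relation.Unary using (_⊆_)
open import Axiom.ExcludedMiddle using (ExcludedMiddle)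
open import Function.Bundles using (Equivalence)

-- Let P (Inner below) be the set of vertices lying strictly on the A-side of
-- both separations.  If P is empty, every vertex of A_X lies in B_Y and every vertex
-- of A_Y in B_X, so the separations are nested.  Otherwise P avoids B_X ⊇ X and
-- B_Y ⊇ Y, and a neighbour w ∉ X ∩ Y of a vertex of P is again in P: it lies in
-- A_X ∩ A_Y, and w ∈ B_X would force w ∈ X ⊆ B_Y, hence w ∈ X ∩ Y.  So the
-- component of G - (X ∩ Y) through a vertex of P stays inside P.

module Walks (G : Graph) where
  open Graph G

  _++_ : ∀ {S a b c} → WalkIn G S a b → WalkIn G S b c → WalkIn G S a c
  nil s      ++ q = q
  cons s e p ++ q = cons s e (p ++ q)

  head : ∀ {S a b} → WalkIn G S a b → S a
  head (nil s)      = s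
  head (cons s e p) = s

  reverse : ∀ {S a b} → WalkIn G S a b → WalkIn G S b a
  reverse (nil s)      = nil s
  reverse (cons s e p) = reverse p ++ cons (head p) (sym e) (nil s)

module Reachability (G : Graph) where
  open Graph G
  open Walks G

  ReachableIn : VSet G → V → VSet G
  ReachableIn S v u = WalkIn G S u v

  reachableIn-⊆ : ∀ {S v} → ReachableIn S v ⊆ S
  reachableIn-⊆ = head

  walk-reachableIn : ∀ {S a b v} → WalkIn G S a b → WalkIn G S b v →
                     WalkIn G (ReachableIn S v) a b
  walk-reachableIn (nil s)      q = nil q
  walk-reachableIn (cons s e p) q = cons (cons s e p ++ q) e (walk-reachableIn p q)

  -- A set S avoiding Z and closed under adjacency in G - Z is a union of
  -- components of G - Z; the one through v is what v reaches inside S.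
  reachableIn-isComponent : ∀ {Z S v} →
    (∀ u → S u → ¬ Z u) →
    (∀ {u w} → S u → E u w → ¬ Z w → S w) →
    S v → IsComponentOfMinus G Z (ReachableIn S v)
  reachableIn-isComponent {v = v} avoids closed sv = record
    { nonempty  = v , nil sv
    ; avoids    = λ u r → avoids u (head r)
    ; connected = λ u w ru rw → walk-reachableIn (ru ++ reverse rw) rw
    ; maximal   = λ u w ru e ¬zw → cons (closed (head ru) e ¬zw) (sym e) ru
    }

module Separations (em : ExcludedMiddle 0ℓ) (G : Graph) where
  open Graph G

  Strict : VSet G → VSet G → VSet G
  Strict A B u = A u × ¬ B u

  strict-neighbour-∈ : ∀ {A B u w} → IsSeparation G A B →
                       Strict A B u → E u w → A w
  strict-neighbour-∈ {A = A} {u = u} {w = w} (cover , noEdge) (au , ¬bu) e with em {A w}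
  ... | yes aw = aw
  ... | no ¬aw with cover w
  ...   | inj₁ aw = ⊥-elim (¬aw aw)
  ...   | inj₂ bw = ⊥-elim (noEdge u w au ¬bu bw ¬aw e)

  ∉-side-∈-other : ∀ {A B u} → IsSeparation G A B → ¬ B u → A u
  ∉-side-∈-other {u = u} (cover , _) ¬bu with cover u
  ... | inj₁ au = au
  ... | inj₂ bu = ⊥-elim (¬bu bu)

  separator-⊆ : ∀ {A B X} → _≐_ G (_∩_ G A B) X → X ⊆ B
  separator-⊆ eq x = proj₂ (Equivalence.from (eq _) x)

  ⊆-separator : ∀ {A B X u} → _≐_ G (_∩_ G A B) X → A u → B u → X u
  ⊆-separator eq a b = Equivalence.to (eq _) (a , b)

  strict-avoids : ∀ {A B X} → _≐_ G (_∩_ G A B) X → ∀ u → Strict A B u → ¬ X u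
  strict-avoids eq u (_ , ¬bu) x = ¬bu (separator-⊆ eq x)

module CrossingSeparations (em : ExcludedMiddle 0ℓ) (G : Graph)
    (X Y AX BX AY BY : VSet G)
    (sepX : IsSeparation G AX BX) (sepY : IsSeparation G AY BY)
    (eqX : _≐_ G (_∩_ G AX BX) X) (eqY : _≐_ G (_∩_ G AY BY) Y)
    (Y⊆BX : Y ⊆ BX) (X⊆BY : X ⊆ BY) where
  open Graph G
  open Separations em G
  open Reachability G

  Inner : VSet G
  Inner u = Strict AX BX u × Strict AY BY u

  inner-avoids-X : ∀ u → Inner u → ¬ X u
  inner-avoids-X u (inX , _) = strict-avoids eqX u inX

  inner-avoids-Y : ∀ u → Inner u → ¬ Y u
  inner-avoids-Y u (_ , inY) = strict-avoids eqY u inY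

  inner-avoids-X∩Y : ∀ u → Inner u → ¬ _∩_ G X Y u
  inner-avoids-X∩Y u i (x , _) = inner-avoids-X u i x

  inner-neighbour : ∀ {u w} → Inner u → E u w → ¬ _∩_ G X Y w → Inner w
  inner-neighbour (inX , inY) e ¬xyw = (axw , ¬bxw) , (ayw , ¬byw)
    where
    axw = strict-neighbour-∈ sepX inX e
    ayw = strict-neighbour-∈ sepY inY e
    ¬bxw : ¬ BX _
    ¬bxw bxw = let x = ⊆-separator eqX axw bxw in
      ¬xyw (x , ⊆-separator eqY ayw (X⊆BY x))
    ¬byw : ¬ BY _
    ¬byw byw = let y = ⊆-separator eqY ayw byw in
      ¬xyw (⊆-separator eqX axw (Y⊆BX y) , y)

  inner-component : ∀ {v} → Inner v →
    Σ (VSet G) (λ C → IsComponentOfMinus G (_∩_ G X Y) C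
                        × ¬ Meets G C X × ¬ Meets G C Y)
  inner-component {v} iv =
      ReachableIn Inner v
    , reachableIn-isComponent inner-avoids-X∩Y inner-neighbour iv
    , (λ { (u , r , x) → inner-avoids-X u (reachableIn-⊆ r) x })
    , (λ { (u , r , y) → inner-avoids-Y u (reachableIn-⊆ r) y })

  AX-∖-BY-inner : ∀ {u} → AX u → ¬ BY u → Inner u
  AX-∖-BY-inner axu ¬byu =
      (axu , λ bxu → ¬byu (X⊆BY (⊆-separator eqX axu bxu)))
    , (∉-side-∈-other sepY ¬byu , ¬byu)

  AY-∖-BX-inner : ∀ {u} → AY u → ¬ BX u → Inner u
  AY-∖-BX-inner ayu ¬bxu =
      (∉-side-∈-other sepX ¬bxu , ¬bxu)
    , (ayu , λ byu → ¬bxu (Y⊆BX (⊆-separator eqY ayu byu)))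

  ⊆-of-no-inner : ∀ {A B : VSet G} → (∀ {u} → A u → ¬ B u → Inner u) → ¬ ∃ Inner → A ⊆ B
  ⊆-of-no-inner {B = B} inner ¬inner {u} au with em {B u}
  ... | yes bu = bu
  ... | no ¬bu = ⊥-elim (¬inner (u , inner au ¬bu))

  nested-or-inner-component :
    Nested G AX BX AY BY
      ⊎ Σ (VSet G) (λ C → IsComponentOfMinus G (_∩_ G X Y) C
                            × ¬ Meets G C X × ¬ Meets G C Y)
  nested-or-inner-component with em {∃ Inner}
  ... | yes (v , iv) = inj₂ (inner-component iv)
  ... | no ¬inner    = inj₁ (inj₂ (inj₁ ( ⊆-of-no-inner AX-∖-BY-inner ¬inner
                                        , ⊆-of-no-inner AY-∖-BX-inner ¬inner)))

lemma6p18 : ExcludedMiddle 0ℓ →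
    (G : Graph) (X Y AX BX AY BY : VSet G) →
    ¬ (_≐_ G X Y) →
    StronglyNested G X Y →
    IsSeparation G AX BX → IsSeparation G AY BY →
    _≐_ G (_∩_ G AX BX) X → _≐_ G (_∩_ G AY BY) Y →
    Y ⊆ BX → X ⊆ BY →
    Nested G AX BX AY BY
      ⊎ Σ (VSet G) (λ C → IsComponentOfMinus G (_∩_ G X Y) C
                            × ¬ Meets G C X × ¬ Meets G C Y)
lemma6p18 em G X Y AX BX AY BY _ _ =
  CrossingSeparations.nested-or-inner-component em G X Y AX BX AY BY
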